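{- Let $N\geq 1$ and $l\geq 2$ be integers, let $w=e^{2\pi {\rm i}/l}$, and let $H\in M_N(\mathbb C)$ be a circulant complex Hadamard matrix all of whose entries are $l$-th roots of unity. For $i=0,\ldots,l-1$ let $a_i\in\mathbb N$ be the number of entries equal to $w^i$ in the first row of $H$ (so $\sum_i a_i=N$). Then $$\sum_{i,k=0}^{l-1}w^k a_i a_{i+k}=N,$$ where the indices of $a$ are taken modulo $l$.
   Context: A complex Hadamard matrix is a square matrix $H\in M_N(\mathbb C)$ whose entries all have modulus $1$ and whose rows are pairwise orthogonal (with respect to the standard Hermitian inner product). A matrix is circulant if $H_{ij}=\xi_{j-i}$ for some vector $\xi$, indices modulo $N$. -}

module Defs where

open import Level using (Level)
open import Data.Nat using (ℕ; zero; suc; _<_; NonZero)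
import Data.Nat as ℕ
open import Data.Nat.DivMod using (_mod_)
open import Data.Fin using (Fin; toℕ) renaming (zero to fzero; suc to fsuc)
open import Data.Fin.Properties using (_≟_)
open import Relation.Nullary using (¬_; yes; no)
open import Relation.Binary.PropositionalEquality using (_≡_)
open import Data.Product using (Σ; _×_)
open import Algebra.Bundles using (CommutativeRing)

_⊕_ : ∀ {n} .{{_ : NonZero n}} → Fin n → Fin n → Fin n
_⊕_ {n} i j = (toℕ i ℕ.+ toℕ j) mod n

_⊖_ : ∀ {n} .{{_ : NonZero n}} → Fin n → Fin n → Fin n
_⊖_ {n} j i = (toℕ j ℕ.+ (n ℕ.∸ toℕ i)) mod n

count : ∀ {n m} → (Fin n → Fin m) → Fin m → ℕ
count {zero}  f i = 0
count {suc n} f i with f fzero ≟ i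
... | yes _ = suc (count (λ j → f (fsuc j)) i)
... | no  _ = count (λ j → f (fsuc j)) i

module _ {c ℓ : Level} (R : CommutativeRing c ℓ) where
  open CommutativeRing R

  pow : Carrier → ℕ → Carrier
  pow x zero    = 1#
  pow x (suc k) = x * pow x k

  nat : ℕ → Carrier
  nat zero    = 0#
  nat (suc k) = 1# + nat k

  sumF : ∀ {n} → (Fin n → Carrier) → Carrier
  sumF {zero}  f = 0#
  sumF {suc n} f = f fzero + sumF (λ j → f (fsuc j))

  -- A conjugation: an involutive ring endomorphism compatible with ≈
  -- (the abstract counterpart of complex conjugation).
  record IsConjugation (conj : Carrier → Carrier) : Set (c Level.⊔ ℓ) where
    field
      cong-≈  : ∀ {x y} → x ≈ y → conj x ≈ conj y
      conj-+  : ∀ x y → conj (x + y) ≈ conj x + conj y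
      conj-*  : ∀ x y → conj (x * y) ≈ conj x * conj y
      conj-1  : conj 1# ≈ 1#
      conj-invol : ∀ x → conj (conj x) ≈ x

  IsPrimitiveUnitRoot : (conj : Carrier → Carrier) → ℕ → Carrier → Set ℓ
  IsPrimitiveUnitRoot conj l w =
    (pow w l ≈ 1#) × (conj w * w ≈ 1#)
    × (∀ k → 0 < k → k < l → ¬ (pow w k ≈ 1#))

  IsComplexHadamard : (conj : Carrier → Carrier) → ∀ {N} → (Fin N → Fin N → Carrier) → Set ℓ
  IsComplexHadamard conj {N} H =
    (∀ i j → conj (H i j) * H i j ≈ 1#)
    × (∀ r s → ¬ (r ≡ s) → sumF (λ j → H r j * conj (H s j)) ≈ 0#)

  IsCirculant : ∀ {N} .{{_ : NonZero N}} → (Fin N → Fin N → Carrier) → Set (c Level.⊔ ℓ)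
  IsCirculant {N} H = Σ (Fin N → Carrier) λ ξ → ∀ i j → H i j ≈ ξ (j ⊖ i)

-- The proof separates a counting identity from the Hadamard property.
--  * Autocorrelation: for ANY weight χ on ℤ/l and any x : Fin N → Fin l,
--      Σ_{i,k} χ(k) a_i a_{i+k} = Σ_{t,j} χ(x_j - x_t).
--    It follows from the change of variables Σ_i a_i G(i) = Σ_t G(x_t)
--    (written with a Kronecker delta and the sifting property), used twice,
--    together with the fact that counting is invariant under the shift
--    i ↦ i - x_t of ℤ/l.
--  * Row-sum norm: for a circulant Hadamard matrix every column sum equals
--    the first-row sum, so Σ_{t,j} H_0j conj(H_0t) = Σ_s ⟨row 0, row s⟩ = N.
--  * With χ(k) = w^k and w^l = 1, H_0j conj(H_0t) = w^(x_j - x_t), which glues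
--    the two identities together.
module Submission where

open import Defs
open import Level using (Level)
open import Data.Nat using (ℕ; suc; _≤_; NonZero)
import Data.Nat as ℕ
open import Data.Fin using (Fin; toℕ) renaming (zero to fzero; suc to fsuc)
open import Data.Fin.Properties using (_≟_)
open import Data.Product using (_,_)
open import Function.Base using (_∘_)
open import Function.Bundles using (_⇔_; mk⇔; Equivalence)
open import Relation.Nullary using (yes; no; does; contradiction)
open import Relation.Binary.PropositionalEquality as ≡ using (_≡_)
open import Algebra.Bundles using (CommutativeRing)

module Modular where
  open import Data.Nat using (_+_; _∸_)
  open import Data.Nat.Properties
    using (+-comm; +-assoc; m+[n∸m]≡n; <⇒≤; +-commutativeSemigroup)
  open import Algebra.Properties.CommutativeSemigroup +-commutativeSemigroup
    using (x∙yz≈y∙xz)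
  open import Data.Nat.DivMod
    using (_%_; _mod_; m%n<n; %-distribˡ-+; m%n%n≡m%n; [m+n]%n≡m%n; m<n⇒m%n≡m)
  open import Data.Fin.Properties using (toℕ-fromℕ<; toℕ-injective; toℕ<n)
  open ≡ using (cong; sym; trans)
  open ≡.≡-Reasoning

  [m%d+k]%d≡[m+k]%d : ∀ m k d .{{_ : NonZero d}} → (m % d + k) % d ≡ (m + k) % d
  [m%d+k]%d≡[m+k]%d m k d = begin
    (m % d + k) % d         ≡⟨ %-distribˡ-+ (m % d) k d ⟩
    (m % d % d + k % d) % d ≡⟨ cong (λ z → (z + k % d) % d) (m%n%n≡m%n m d) ⟩
    (m % d + k % d) % d     ≡⟨ %-distribˡ-+ m k d ⟨
    (m + k) % d             ∎

  [m+k%d]%d≡[m+k]%d : ∀ m k d .{{_ : NonZero d}} → (m + k % d) % d ≡ (m + k) % d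
  [m+k%d]%d≡[m+k]%d m k d = begin
    (m + k % d) % d ≡⟨ cong (_% d) (+-comm m (k % d)) ⟩
    (k % d + m) % d ≡⟨ [m%d+k]%d≡[m+k]%d k m d ⟩
    (k + m) % d     ≡⟨ cong (_% d) (+-comm k m) ⟩
    (m + k) % d     ∎

  module _ {n : ℕ} .{{_ : NonZero n}} where

    toℕ-mod : ∀ m → toℕ (m mod n) ≡ m % n
    toℕ-mod m = toℕ-fromℕ< (m%n<n m n)

    absorb : ∀ {a} c → a ≤ n → (a + (c + (n ∸ a))) % n ≡ c % n
    absorb {a} c a≤n = begin
      (a + (c + (n ∸ a))) % n ≡⟨ cong (_% n) (x∙yz≈y∙xz a c (n ∸ a)) ⟩
      (c + (a + (n ∸ a))) % n ≡⟨ cong (λ z → (c + z) % n) (m+[n∸m]≡n a≤n) ⟩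
      (c + n) % n             ≡⟨ [m+n]%n≡m%n c n ⟩
      c % n                   ∎

    ⊕-comm : (a b : Fin n) → a ⊕ b ≡ b ⊕ a
    ⊕-comm a b = cong (_mod n) (+-comm (toℕ a) (toℕ b))

    ⊕-⊖-cancel : (a b : Fin n) → a ⊕ (b ⊖ a) ≡ b
    ⊕-⊖-cancel a b = toℕ-injective (begin
      toℕ (a ⊕ (b ⊖ a))             ≡⟨ toℕ-mod _ ⟩
      (A + toℕ (b ⊖ a)) % n         ≡⟨ cong (λ z → (A + z) % n) (toℕ-mod _) ⟩
      (A + (B + (n ∸ A)) % n) % n   ≡⟨ [m+k%d]%d≡[m+k]%d A _ n ⟩
      (A + (B + (n ∸ A))) % n       ≡⟨ absorb B (<⇒≤ (toℕ<n a)) ⟩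
      B % n                         ≡⟨ m<n⇒m%n≡m (toℕ<n b) ⟩
      B                             ∎)
      where A = toℕ a ; B = toℕ b

    ⊖-⊕-cancel : (a k : Fin n) → (a ⊕ k) ⊖ a ≡ k
    ⊖-⊕-cancel a k = toℕ-injective (begin
      toℕ ((a ⊕ k) ⊖ a)             ≡⟨ toℕ-mod _ ⟩
      (toℕ (a ⊕ k) + (n ∸ A)) % n   ≡⟨ cong (λ z → (z + (n ∸ A)) % n) (toℕ-mod _) ⟩
      ((A + K) % n + (n ∸ A)) % n   ≡⟨ [m%d+k]%d≡[m+k]%d (A + K) _ n ⟩
      (A + K + (n ∸ A)) % n         ≡⟨ cong (_% n) (+-assoc A K _) ⟩
      (A + (K + (n ∸ A))) % n       ≡⟨ absorb K (<⇒≤ (toℕ<n a)) ⟩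
      K % n                         ≡⟨ m<n⇒m%n≡m (toℕ<n k) ⟩
      K                             ∎)
      where A = toℕ a ; K = toℕ k

    shift-⇔ : (a b k : Fin n) → (b ≡ a ⊕ k) ⇔ (b ⊖ a ≡ k)
    shift-⇔ a b k = mk⇔
      (λ b≡a⊕k → trans (cong (_⊖ a) b≡a⊕k) (⊖-⊕-cancel a k))
      (λ b⊖a≡k → trans (sym (⊕-⊖-cancel a b)) (cong (a ⊕_) b⊖a≡k))

    ⊖-involutive : (j s : Fin n) → j ⊖ (j ⊖ s) ≡ s
    ⊖-involutive j s = begin
      j ⊖ (j ⊖ s)             ≡⟨ cong (_⊖ (j ⊖ s)) (trans (⊕-comm (j ⊖ s) s) (⊕-⊖-cancel s j)) ⟨
      ((j ⊖ s) ⊕ s) ⊖ (j ⊖ s) ≡⟨ ⊖-⊕-cancel (j ⊖ s) s ⟩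
      s                       ∎

  ⊖-zero : ∀ {m} (t : Fin (suc m)) → t ⊖ fzero ≡ t
  ⊖-zero {m} t = toℕ-injective (begin
    toℕ (t ⊖ fzero)         ≡⟨ toℕ-mod {suc m} (toℕ t + suc m) ⟩
    (toℕ t + suc m) % suc m ≡⟨ [m+n]%n≡m%n (toℕ t) (suc m) ⟩
    toℕ t % suc m           ≡⟨ m<n⇒m%n≡m (toℕ<n t) ⟩
    toℕ t                   ∎)

open Modular using (toℕ-mod; ⊕-⊖-cancel; shift-⇔; ⊖-involutive; ⊖-zero)

count-cong : ∀ {n m k} (f : Fin n → Fin m) (g : Fin n → Fin k) {i : Fin m} {j : Fin k}
  → (∀ t → (f t ≡ i) ⇔ (g t ≡ j)) → count f i ≡ count g j
count-cong {ℕ.zero} f g f⇔g = ≡.refl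
count-cong {suc n} f g {i} {j} f⇔g with f fzero ≟ i | g fzero ≟ j
... | yes _  | yes _  = ≡.cong suc (count-cong (f ∘ fsuc) (g ∘ fsuc) (f⇔g ∘ fsuc))
... | no _   | no _   = count-cong (f ∘ fsuc) (g ∘ fsuc) (f⇔g ∘ fsuc)
... | yes p  | no ¬q  = contradiction (Equivalence.to (f⇔g fzero) p) ¬q
... | no ¬p  | yes q  = contradiction (Equivalence.from (f⇔g fzero) q) ¬p

count-shift : ∀ {n l} .{{_ : NonZero l}} (x : Fin n → Fin l) (y k : Fin l)
  → count x (y ⊕ k) ≡ count (λ t → x t ⊖ y) k
count-shift x y k = count-cong x (λ t → x t ⊖ y) (λ t → shift-⇔ y (x t) k)

module RingLemmas {c ℓ : Level} (R : CommutativeRing c ℓ) where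
  open CommutativeRing R
  open import Algebra.Properties.Semiring.Sum semiring
    using (sum; sum-cong-≋; sum-replicate-zero; *-distribˡ-sum; *-distribʳ-sum; ∑-comm; ∑-permute)
  open import Algebra.Properties.Semiring.Mult semiring using (_×_; ×1-homo-*)
  open import Algebra.Properties.CommutativeSemigroup *-commutativeSemigroup
    using (x∙yz≈y∙xz)
  open import Data.Fin.Permutation using (permutation)
  open import Data.Bool using (if_then_else_)
  open import Data.Nat.DivMod using (_%_; _/_; m≡m%n+[m/n]*n)
  open import Relation.Binary.Reasoning.Setoid setoid

  -- Finite sums.  sumF is the library's sum written by explicit recursion, so
  -- its laws are transported from Algebra.Properties.Semiring.Sum.

  sumF≡sum : ∀ {m} (f : Fin m → Carrier) → sumF R f ≡ sum f
  sumF≡sum {ℕ.zero} f = ≡.refl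
  sumF≡sum {suc m} f = ≡.cong (f fzero +_) (sumF≡sum (f ∘ fsuc))

  via-sum : ∀ {m k} (f : Fin m → Carrier) (g : Fin k → Carrier)
    → sum f ≈ sum g → sumF R f ≈ sumF R g
  via-sum f g eq = begin
    sumF R f ≡⟨ sumF≡sum f ⟩
    sum f    ≈⟨ eq ⟩
    sum g    ≡⟨ sumF≡sum g ⟨
    sumF R g ∎

  sumF-cong : ∀ {m} {f g : Fin m → Carrier} → (∀ i → f i ≈ g i) → sumF R f ≈ sumF R g
  sumF-cong {f = f} {g} f≈g = via-sum f g (sum-cong-≋ f≈g)

  sumF-zero : ∀ m → sumF R {m} (λ _ → 0#) ≈ 0#
  sumF-zero m = trans (reflexive (sumF≡sum {m} (λ _ → 0#))) (sum-replicate-zero m)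

  sumF-distribˡ : ∀ {m} x (f : Fin m → Carrier) → x * sumF R f ≈ sumF R (λ i → x * f i)
  sumF-distribˡ x f = begin
    x * sumF R f           ≡⟨ ≡.cong (x *_) (sumF≡sum f) ⟩
    x * sum f              ≈⟨ *-distribˡ-sum x f ⟩
    sum (λ i → x * f i)    ≡⟨ sumF≡sum (λ i → x * f i) ⟨
    sumF R (λ i → x * f i) ∎

  sumF-distribʳ : ∀ {m} x (f : Fin m → Carrier) → sumF R f * x ≈ sumF R (λ i → f i * x)
  sumF-distribʳ x f = begin
    sumF R f * x           ≡⟨ ≡.cong (_* x) (sumF≡sum f) ⟩
    sum f * x              ≈⟨ *-distribʳ-sum x f ⟩
    sum (λ i → f i * x)    ≡⟨ sumF≡sum (λ i → f i * x) ⟨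
    sumF R (λ i → f i * x) ∎

  sumF-swap : ∀ {m k} (f : Fin m → Fin k → Carrier)
    → sumF R (λ i → sumF R (f i)) ≈ sumF R (λ j → sumF R (λ i → f i j))
  sumF-swap f = begin
    sumF R (λ i → sumF R (f i))         ≈⟨ sumF-cong (λ i → reflexive (sumF≡sum (f i))) ⟩
    sumF R (λ i → sum (f i))            ≈⟨ via-sum (λ i → sum (f i)) (λ j → sum (λ i → f i j)) (∑-comm f) ⟩
    sumF R (λ j → sum (λ i → f i j))    ≈⟨ sumF-cong (λ j → reflexive (≡.sym (sumF≡sum (λ i → f i j)))) ⟩
    sumF R (λ j → sumF R (λ i → f i j)) ∎

  sumF-reindex : ∀ {m} (π : Fin m → Fin m) → (∀ i → π (π i) ≡ i)
    → (f : Fin m → Carrier) → sumF R (f ∘ π) ≈ sumF R f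
  sumF-reindex π π-invol f = via-sum (f ∘ π) f (sym (∑-permute f (permutation π π π-invol π-invol)))

  -- Natural numbers in R: nat is the library's  (_× 1#), hence multiplicative.

  nat≡×1 : ∀ k → nat R k ≡ k × 1#
  nat≡×1 ℕ.zero = ≡.refl
  nat≡×1 (suc k) = ≡.cong (1# +_) (nat≡×1 k)

  nat-* : ∀ m k → nat R (m ℕ.* k) ≈ nat R m * nat R k
  nat-* m k = begin
    nat R (m ℕ.* k)        ≡⟨ nat≡×1 (m ℕ.* k) ⟩
    (m ℕ.* k) × 1#         ≈⟨ ×1-homo-* m k ⟩
    (m × 1#) * (k × 1#)    ≡⟨ ≡.cong₂ _*_ (nat≡×1 m) (nat≡×1 k) ⟨
    nat R m * nat R k      ∎

  sumF-ones : ∀ m → sumF R {m} (λ _ → 1#) ≡ nat R m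
  sumF-ones ℕ.zero = ≡.refl
  sumF-ones (suc m) = ≡.cong (1# +_) (sumF-ones m)

  δ : ∀ {m} → Fin m → Fin m → Carrier
  δ p q = if does (p ≟ q) then 1# else 0#

  δ-sift : ∀ {m} (a : Fin m) (F : Fin m → Carrier) → sumF R (λ i → δ a i * F i) ≈ F a
  δ-sift {suc m} fzero F = begin
    1# * F fzero + sumF R (λ i → 0# * F (fsuc i)) ≈⟨ +-cong (*-identityˡ _) (sumF-cong (λ i → zeroˡ (F (fsuc i)))) ⟩
    F fzero + sumF R {m} (λ _ → 0#)               ≈⟨ +-congˡ (sumF-zero m) ⟩
    F fzero + 0#                                  ≈⟨ +-identityʳ _ ⟩
    F fzero                                       ∎
  δ-sift {suc m} (fsuc a) F = begin
    0# * F fzero + sumF R (λ i → δ a i * F (fsuc i)) ≈⟨ +-cong (zeroˡ _) (δ-sift a (F ∘ fsuc)) ⟩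
    0# + F (fsuc a)                                  ≈⟨ +-identityˡ _ ⟩
    F (fsuc a)                                       ∎

  count≈sum-δ : ∀ {n m} (x : Fin n → Fin m) (i : Fin m)
    → nat R (count x i) ≈ sumF R (λ t → δ (x t) i)
  count≈sum-δ {ℕ.zero} x i = refl
  count≈sum-δ {suc n} x i with x fzero ≟ i
  ... | yes _ = +-congˡ (count≈sum-δ (x ∘ fsuc) i)
  ... | no _  = trans (sym (+-identityˡ _)) (+-congˡ (count≈sum-δ (x ∘ fsuc) i))

  sum-count : ∀ {n m} (x : Fin n → Fin m) (G : Fin m → Carrier)
    → sumF R (λ i → nat R (count x i) * G i) ≈ sumF R (λ t → G (x t))
  sum-count x G = begin
    sumF R (λ i → nat R (count x i) * G i)          ≈⟨ sumF-cong (λ i →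
                                                         trans (*-congʳ (count≈sum-δ x i)) (sumF-distribʳ (G i) (λ t → δ (x t) i))) ⟩
    sumF R (λ i → sumF R (λ t → δ (x t) i * G i))   ≈⟨ sumF-swap (λ i t → δ (x t) i * G i) ⟩
    sumF R (λ t → sumF R (λ i → δ (x t) i * G i))   ≈⟨ sumF-cong (λ t → δ-sift (x t) G) ⟩
    sumF R (λ t → G (x t))                          ∎

  autocorrelation : ∀ {n l} .{{_ : NonZero l}} (χ : Fin l → Carrier) (x : Fin n → Fin l)
    → sumF R (λ i → sumF R (λ k → χ k * nat R (count x i ℕ.* count x (i ⊕ k))))
      ≈ sumF R (λ t → sumF R (λ j → χ (x j ⊖ x t)))
  autocorrelation χ x = begin
    sumF R (λ i → sumF R (λ k → χ k * nat R (a i ℕ.* a (i ⊕ k))))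
      ≈⟨ sumF-cong (λ i → sumF-cong (λ k → factor-out i k)) ⟩
    sumF R (λ i → sumF R (λ k → nat R (a i) * (χ k * nat R (a (i ⊕ k)))))
      ≈⟨ sumF-cong (λ i → sym (sumF-distribˡ (nat R (a i)) (λ k → χ k * nat R (a (i ⊕ k))))) ⟩
    sumF R (λ i → nat R (a i) * sumF R (λ k → χ k * nat R (a (i ⊕ k))))
      ≈⟨ sum-count x _ ⟩
    sumF R (λ t → sumF R (λ k → χ k * nat R (a (x t ⊕ k))))
      ≈⟨ sumF-cong (λ t → sumF-cong (λ k →
           trans (*-comm _ _) (*-congʳ (reflexive (≡.cong (nat R) (count-shift x (x t) k)))))) ⟩
    sumF R (λ t → sumF R (λ k → nat R (count (λ j → x j ⊖ x t) k) * χ k))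
      ≈⟨ sumF-cong (λ t → sum-count (λ j → x j ⊖ x t) χ) ⟩
    sumF R (λ t → sumF R (λ j → χ (x j ⊖ x t)))
      ∎
    where
    a : Fin _ → ℕ
    a = count x
    factor-out : ∀ i k → χ k * nat R (a i ℕ.* a (i ⊕ k)) ≈ nat R (a i) * (χ k * nat R (a (i ⊕ k)))
    factor-out i k = trans (*-congˡ (nat-* (a i) (a (i ⊕ k)))) (x∙yz≈y∙xz _ _ _)

  pow-+ : ∀ w m k → pow R w (m ℕ.+ k) ≈ pow R w m * pow R w k
  pow-+ w ℕ.zero k = sym (*-identityˡ _)
  pow-+ w (suc m) k = trans (*-congˡ (pow-+ w m k)) (sym (*-assoc _ _ _))

  pow-multiple : ∀ w l → pow R w l ≈ 1# → ∀ q → pow R w (q ℕ.* l) ≈ 1#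
  pow-multiple w l wˡ≈1 ℕ.zero = refl
  pow-multiple w l wˡ≈1 (suc q) = begin
    pow R w (l ℕ.+ q ℕ.* l)        ≈⟨ pow-+ w l (q ℕ.* l) ⟩
    pow R w l * pow R w (q ℕ.* l)  ≈⟨ *-cong wˡ≈1 (pow-multiple w l wˡ≈1 q) ⟩
    1# * 1#                        ≈⟨ *-identityˡ 1# ⟩
    1#                             ∎

  pow-mod : ∀ w l .{{_ : NonZero l}} → pow R w l ≈ 1# → ∀ m → pow R w (m % l) ≈ pow R w m
  pow-mod w l wˡ≈1 m = begin
    pow R w (m % l)                        ≈⟨ *-identityʳ _ ⟨
    pow R w (m % l) * 1#                   ≈⟨ *-congˡ (pow-multiple w l wˡ≈1 (m / l)) ⟨
    pow R w (m % l) * pow R w (m / l ℕ.* l) ≈⟨ pow-+ w (m % l) _ ⟨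
    pow R w (m % l ℕ.+ m / l ℕ.* l)        ≡⟨ ≡.cong (pow R w) (m≡m%n+[m/n]*n m l) ⟨
    pow R w m                              ∎

  pow-⊖ : ∀ w {l} .{{_ : NonZero l}} → pow R w l ≈ 1# → (a b : Fin l)
    → pow R w (toℕ (b ⊖ a)) * pow R w (toℕ a) ≈ pow R w (toℕ b)
  pow-⊖ w {l} wˡ≈1 a b = begin
    pow R w (toℕ (b ⊖ a)) * pow R w (toℕ a) ≈⟨ *-comm _ _ ⟩
    pow R w (toℕ a) * pow R w (toℕ (b ⊖ a)) ≈⟨ pow-+ w (toℕ a) _ ⟨
    pow R w (toℕ a ℕ.+ toℕ (b ⊖ a))         ≈⟨ pow-mod w l wˡ≈1 _ ⟨
    pow R w ((toℕ a ℕ.+ toℕ (b ⊖ a)) % l)   ≡⟨ ≡.cong (pow R w) (toℕ-mod _) ⟨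
    pow R w (toℕ (a ⊕ (b ⊖ a)))             ≡⟨ ≡.cong (pow R w ∘ toℕ) (⊕-⊖-cancel a b) ⟩
    pow R w (toℕ b)                         ∎

  ratio-of-roots : ∀ w {l} .{{_ : NonZero l}} → pow R w l ≈ 1# → (a b : Fin l) {u v v′ : Carrier}
    → u ≈ pow R w (toℕ a) → v ≈ pow R w (toℕ b) → v * v′ ≈ 1#
    → u * v′ ≈ pow R w (toℕ (a ⊖ b))
  ratio-of-roots w wˡ≈1 a b {u} {v} {v′} u≈wᵃ v≈wᵇ vv′≈1 = begin
    u * v′                              ≈⟨ *-congʳ (trans u≈wᵃ (sym (pow-⊖ w wˡ≈1 b a))) ⟩
    (r * pow R w (toℕ b)) * v′          ≈⟨ *-congʳ (*-congˡ (sym v≈wᵇ)) ⟩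
    (r * v) * v′                        ≈⟨ *-assoc _ _ _ ⟩
    r * (v * v′)                        ≈⟨ *-congˡ vv′≈1 ⟩
    r * 1#                              ≈⟨ *-identityʳ r ⟩
    r                                   ∎
    where
    r : Carrier
    r = pow R w (toℕ (a ⊖ b))

  module _ (conj : Carrier → Carrier) {n : ℕ} (H : Fin (suc n) → Fin (suc n) → Carrier) where

    circulant-column-sum : IsCirculant R H → (g : Carrier → Carrier) → (∀ {x y} → x ≈ y → g x ≈ g y)
      → ∀ j → sumF R (λ s → g (H s j)) ≈ sumF R (λ t → g (H fzero t))
    circulant-column-sum (ξ , H≈ξ) g g-cong j = begin
      sumF R (λ s → g (H s j))       ≈⟨ sumF-cong (λ s → g-cong (H≈ξ s j)) ⟩
      sumF R (λ s → g (ξ (j ⊖ s)))   ≈⟨ sumF-reindex (j ⊖_) (⊖-involutive j) (g ∘ ξ) ⟩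
      sumF R (λ t → g (ξ t))         ≈⟨ sumF-cong (λ t → g-cong (first-row t)) ⟨
      sumF R (λ t → g (H fzero t))   ∎
      where
      first-row : ∀ t → H fzero t ≈ ξ t
      first-row t = trans (H≈ξ fzero t) (reflexive (≡.cong ξ (⊖-zero t)))

    -- The inner products of the first row with all rows of a Hadamard matrix
    -- add up to N: the diagonal term is N, the others vanish.
    first-row-inner-products : IsComplexHadamard R conj H
      → sumF R (λ s → sumF R (λ j → H fzero j * conj (H s j))) ≈ nat R (suc n)
    first-row-inner-products (unimodular , orthogonal) = begin
      sumF R (λ j → H fzero j * conj (H fzero j)) + sumF R (λ s → sumF R (λ j → H fzero j * conj (H (fsuc s) j)))
        ≈⟨ +-cong (sumF-cong (λ j → trans (*-comm _ _) (unimodular fzero j)))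
                  (sumF-cong (λ s → orthogonal fzero (fsuc s) (λ ()))) ⟩
      sumF R {suc n} (λ _ → 1#) + sumF R {n} (λ _ → 0#) ≈⟨ +-congˡ (sumF-zero n) ⟩
      sumF R {suc n} (λ _ → 1#) + 0#                   ≈⟨ +-identityʳ _ ⟩
      sumF R {suc n} (λ _ → 1#)                        ≡⟨ sumF-ones (suc n) ⟩
      nat R (suc n)                                    ∎

    -- The first-row sum σ of a circulant Hadamard matrix has  σ conj(σ) = N,
    -- written as a double sum.
    row-sum-norm : IsConjugation R conj → IsComplexHadamard R conj H → IsCirculant R H
      → sumF R (λ t → sumF R (λ j → H fzero j * conj (H fzero t))) ≈ nat R (suc n)
    row-sum-norm isConj isHadamard isCirculant = begin
      sumF R (λ t → sumF R (λ j → H fzero j * conj (H fzero t))) ≈⟨ sumF-swap (λ t j → H fzero j * conj (H fzero t)) ⟩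
      sumF R (λ j → sumF R (λ t → H fzero j * conj (H fzero t))) ≈⟨ sumF-cong (λ j → sumF-distribˡ (H fzero j) (λ t → conj (H fzero t))) ⟨
      sumF R (λ j → H fzero j * sumF R (λ t → conj (H fzero t))) ≈⟨ sumF-cong (λ j → *-congˡ {H fzero j} (column-sum j)) ⟨
      sumF R (λ j → H fzero j * sumF R (λ s → conj (H s j)))     ≈⟨ sumF-cong (λ j → sumF-distribˡ (H fzero j) (λ s → conj (H s j))) ⟩
      sumF R (λ j → sumF R (λ s → H fzero j * conj (H s j)))     ≈⟨ sumF-swap (λ j s → H fzero j * conj (H s j)) ⟩
      sumF R (λ s → sumF R (λ j → H fzero j * conj (H s j)))     ≈⟨ first-row-inner-products isHadamard ⟩
      nat R (suc n)                                              ∎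
      where
      column-sum : ∀ j → sumF R (λ s → conj (H s j)) ≈ sumF R (λ t → conj (H fzero t))
      column-sum = circulant-column-sum isCirculant conj (IsConjugation.cong-≈ isConj)

open RingLemmas using (sumF-cong; autocorrelation; ratio-of-roots; row-sum-norm)
-- Multiplication of ℕ is opened only here, since RingLemmas uses the ring's _*_.
open import Data.Nat using (_*_)

proposition2p4 : ∀ {c ℓ : Level} (R : CommutativeRing c ℓ)
    (conj : CommutativeRing.Carrier R → CommutativeRing.Carrier R)
    → IsConjugation R conj
    → (n l : ℕ) .{{_ : NonZero l}} → 2 ≤ l
    → (w : CommutativeRing.Carrier R) → IsPrimitiveUnitRoot R conj l w
    → (H : Fin (suc n) → Fin (suc n) → CommutativeRing.Carrier R)
    → IsComplexHadamard R conj H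
    → IsCirculant R H
    → (e : Fin (suc n) → Fin (suc n) → Fin l)
    → (∀ i j → CommutativeRing._≈_ R (H i j) (pow R w (toℕ (e i j))))
    → CommutativeRing._≈_ R
        (sumF R (λ (i : Fin l) → sumF R (λ (k : Fin l) →
          CommutativeRing._*_ R (pow R w (toℕ k))
            (nat R (count (e fzero) i * count (e fzero) (i ⊕ k))))))
        (nat R (suc n))
proposition2p4 R conj isConj n l _ w (wˡ≈1 , _) H isHadamard@(unimodular , _) isCirculant e H≈wᵉ =
  begin
    sumF R (λ i → sumF R (λ k → χ k ∙ nat R (count x i * count x (i ⊕ k))))
      ≈⟨ autocorrelation R χ x ⟩
    sumF R (λ t → sumF R (λ j → χ (x j ⊖ x t)))
      ≈⟨ sumF-cong R (λ t → sumF-cong R (λ j → sym (entry-ratio t j))) ⟩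
    sumF R (λ t → sumF R (λ j → H fzero j ∙ conj (H fzero t)))
      ≈⟨ row-sum-norm R conj H isConj isHadamard isCirculant ⟩
    nat R (suc n)
  ∎
  where
  open CommutativeRing R using (Carrier; _≈_; sym; trans; *-comm; setoid) renaming (_*_ to _∙_)
  open import Relation.Binary.Reasoning.Setoid setoid
  x : Fin (suc n) → Fin l
  x = e fzero
  χ : Fin l → Carrier
  χ k = pow R w (toℕ k)
  entry-ratio : ∀ t j → H fzero j ∙ conj (H fzero t) ≈ χ (x j ⊖ x t)
  entry-ratio t j = ratio-of-roots R w wˡ≈1 (x j) (x t) (H≈wᵉ fzero j) (H≈wᵉ fzero t)
                                    (trans (*-comm _ _) (unimodular fzero t))
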